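{- Let $A$ be a meet-complemented lattice in which $\Diamond a$ exists for every $a\in A$, and let $a,b\in A$. Then (i) $\Diamond(a\wedge b)\le\Diamond a\wedge\Diamond b$; (ii) $\Diamond a\vee\Diamond b\le\Diamond(a\vee b)$; (iii) $\Diamond\neg a\vee\Diamond\neg b\le\Diamond\neg(a\wedge b)$; (iv) $\Diamond\neg(a\wedge b)=\Diamond(\neg a\vee\neg b)$; (v) $\Diamond a=0$ if and only if $a=0$; (vi) $\Diamond 1=1$; (vii) $\neg\Diamond 0=1$.
   Context: A meet-complemented lattice is a lattice $(A,\wedge,\vee)$, not necessarily distributive, such that for every $a\in A$ the element $\neg a=\max\{b\in A: a\wedge b\le c\text{ for all }c\in A\}$ exists; it is bounded, with least element $0$ and greatest element $1$. For $a\in A$, $\Diamond a$ denotes $\min\{b\in A: \neg a\vee b=1\}$, when it exists. -}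

module Defs where

open import Level using (_⊔_)
open import Data.Product using (_×_)
open import Relation.Binary.Lattice.Bundles using (BoundedLattice)

IsMaximum : ∀ {a ℓ p} {A : Set a} → (A → A → Set ℓ) → (A → Set p) → A → Set (a ⊔ ℓ ⊔ p)
IsMaximum _≤_ P x = P x × (∀ y → P y → y ≤ x)

IsMinimum : ∀ {a ℓ p} {A : Set a} → (A → A → Set ℓ) → (A → Set p) → A → Set (a ⊔ ℓ ⊔ p)
IsMinimum _≤_ P x = P x × (∀ y → P y → x ≤ y)

module _ {c ℓ₁ ℓ₂} (L : BoundedLattice c ℓ₁ ℓ₂) where
  open BoundedLattice L

  IsMeetComplement : (Carrier → Carrier) → Set (c ⊔ ℓ₂)
  IsMeetComplement neg = ∀ a → IsMaximum _≤_ (λ b → ∀ x → (a ∧ b) ≤ x) (neg a)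

  IsDiamond : (Carrier → Carrier) → (Carrier → Carrier) → Set (c ⊔ ℓ₁ ⊔ ℓ₂)
  IsDiamond neg dia = ∀ a → IsMinimum _≤_ (λ b → (neg a ∨ b) ≈ ⊤) (dia a)

module Submission where

open import Defs
open import Data.Product using (_×_; _,_; proj₁; proj₂)
open import Function.Bundles using (_⇔_; mk⇔)
open import Relation.Binary.Lattice.Bundles using (BoundedLattice)

module MeetComplement {c ℓ₁ ℓ₂} (L : BoundedLattice c ℓ₁ ℓ₂)
  (neg : BoundedLattice.Carrier L → BoundedLattice.Carrier L)
  (isMC : IsMeetComplement L neg) where
  open BoundedLattice L

  ≤-neg : ∀ {a b} → (a ∧ b) ≤ ⊥ → b ≤ neg a
  ≤-neg {a} {b} a∧b≤⊥ = proj₂ (isMC a) b (λ x → trans a∧b≤⊥ (minimum x))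

  contradiction : ∀ {x a} → x ≤ a → x ≤ neg a → x ≤ ⊥
  contradiction {x} {a} x≤a x≤¬a = trans (∧-greatest x≤a x≤¬a) (proj₁ (isMC a) ⊥)

  -- ¬ reverses order: a ≤ b gives a ∧ ¬b ≤ b ∧ ¬b ≤ 0.
  neg-antitone : ∀ {a b} → a ≤ b → neg b ≤ neg a
  neg-antitone a≤b = ≤-neg (contradiction (trans (x∧y≤x _ _) a≤b) (x∧y≤y _ _))

  neg-⊥ : neg ⊥ ≈ ⊤
  neg-⊥ = antisym (maximum _) (≤-neg (x∧y≤x _ _))

  neg-⊤ : neg ⊤ ≤ ⊥
  neg-⊤ = contradiction (maximum _) refl

  dense⇒⊥ : ∀ {a} → ⊤ ≤ neg a → a ≤ ⊥
  dense⇒⊥ ⊤≤¬a = contradiction refl (trans (maximum _) ⊤≤¬a)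

  -- Double pseudocomplementation preserves binary meets (the nontrivial
  -- inequality).  With d = ¬¬a ∧ ¬¬b ∧ ¬(a ∧ b): a ∧ d ≤ ¬b and ≤ ¬¬b,
  -- so a ∧ d = 0; hence d ≤ ¬a and d ≤ ¬¬a, so d = 0.
  ¬¬-∧ : ∀ a b → (neg (neg a) ∧ neg (neg b)) ≤ neg (neg (a ∧ b))
  ¬¬-∧ a b = ≤-neg (contradiction d≤¬a (trans (x∧y≤y _ _) (x∧y≤x _ _)))
    where
      d = neg (a ∧ b) ∧ (neg (neg a) ∧ neg (neg b))
      a∧d≤¬b : (a ∧ d) ≤ neg b
      a∧d≤¬b = ≤-neg (contradiction
        (∧-greatest (trans (x∧y≤y _ _) (x∧y≤x _ _)) (x∧y≤x _ _))
        (trans (x∧y≤y _ _) (trans (x∧y≤y _ _) (x∧y≤x _ _))))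
      d≤¬a : d ≤ neg a
      d≤¬a = ≤-neg (contradiction a∧d≤¬b
        (trans (x∧y≤y _ _) (trans (x∧y≤y _ _) (x∧y≤y _ _))))

  -- The form used for item (iv): ¬(¬a ∨ ¬b) ≤ ¬¬a ∧ ¬¬b ≤ ¬¬(a ∧ b).
  neg-∨-neg : ∀ a b → neg (neg a ∨ neg b) ≤ neg (neg (a ∧ b))
  neg-∨-neg a b = trans
    (∧-greatest (neg-antitone (x≤x∨y _ _)) (neg-antitone (y≤x∨y _ _)))
    (¬¬-∧ a b)

module Diamond {c ℓ₁ ℓ₂} (L : BoundedLattice c ℓ₁ ℓ₂)
  (neg dia : BoundedLattice.Carrier L → BoundedLattice.Carrier L)
  (isMC : IsMeetComplement L neg) (isDia : IsDiamond L neg dia) where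
  open BoundedLattice L
  open MeetComplement L neg isMC

  ◇-covers : ∀ a → ⊤ ≤ (neg a ∨ dia a)
  ◇-covers a = reflexive (Eq.sym (proj₁ (isDia a)))

  ◇-least : ∀ {a y} → ⊤ ≤ (neg a ∨ y) → dia a ≤ y
  ◇-least {a} {y} ⊤≤¬a∨y = proj₂ (isDia a) y (antisym (maximum _) ⊤≤¬a∨y)

  -- ◇ depends antitonically on the pseudocomplement: if ¬y ≤ ¬x then
  -- ¬x ∨ ◇y ≥ ¬y ∨ ◇y = 1, so ◇x ≤ ◇y.
  ◇-neg-antitone : ∀ {x y} → neg y ≤ neg x → dia x ≤ dia y
  ◇-neg-antitone ¬y≤¬x = ◇-least (trans (◇-covers _)
    (∨-least (trans ¬y≤¬x (x≤x∨y _ _)) (y≤x∨y _ _)))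

  ◇-monotone : ∀ {a b} → a ≤ b → dia a ≤ dia b
  ◇-monotone a≤b = ◇-neg-antitone (neg-antitone a≤b)

  ◇⊥⇒dense : ∀ {a} → dia a ≤ ⊥ → ⊤ ≤ neg a
  ◇⊥⇒dense ◇a≤⊥ = trans (◇-covers _) (∨-least refl (trans ◇a≤⊥ (minimum _)))

  dense⇒◇⊥ : ∀ {a} → ⊤ ≤ neg a → dia a ≤ ⊥
  dense⇒◇⊥ ⊤≤¬a = ◇-least (trans ⊤≤¬a (x≤x∨y _ _))

  -- Item (v): both conditions are equivalent to density of a.
  ◇≈⊥⇔≈⊥ : ∀ a → (dia a ≈ ⊥) ⇔ (a ≈ ⊥)
  ◇≈⊥⇔≈⊥ a = mk⇔
    (λ ◇a≈⊥ → antisym (dense⇒⊥ (◇⊥⇒dense (reflexive ◇a≈⊥))) (minimum _))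
    (λ a≈⊥ → antisym
      (dense⇒◇⊥ (trans (reflexive (Eq.sym neg-⊥)) (neg-antitone (reflexive a≈⊥))))
      (minimum _))

  -- The bottom is dense, so ◇0 = 0 and consequently ¬◇0 = ¬0 = 1.
  ◇-⊥ : dia ⊥ ≈ ⊥
  ◇-⊥ = antisym (dense⇒◇⊥ (reflexive (Eq.sym neg-⊥))) (minimum _)

  neg-◇-⊥ : neg (dia ⊥) ≈ ⊤
  neg-◇-⊥ = antisym (maximum _)
    (trans (reflexive (Eq.sym neg-⊥)) (neg-antitone (reflexive ◇-⊥)))

  ◇-⊤ : ∀ {a} → neg a ≤ ⊥ → dia a ≈ ⊤
  ◇-⊤ ¬a≤⊥ = antisym (maximum _)
    (trans (◇-covers _) (∨-least (trans ¬a≤⊥ (minimum _)) refl))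

proposition6 : ∀ {c ℓ₁ ℓ₂} (L : BoundedLattice c ℓ₁ ℓ₂) →
    let open BoundedLattice L in
    (neg : Carrier → Carrier) → (dia : Carrier → Carrier) →
    IsMeetComplement L neg → IsDiamond L neg dia →
    (a b : Carrier) →
      (dia (a ∧ b) ≤ (dia a ∧ dia b))
      × ((dia a ∨ dia b) ≤ dia (a ∨ b))
      × ((dia (neg a) ∨ dia (neg b)) ≤ dia (neg (a ∧ b)))
      × (dia (neg (a ∧ b)) ≈ dia (neg a ∨ neg b))
      × ((dia a ≈ ⊥) ⇔ (a ≈ ⊥))
      × (dia ⊤ ≈ ⊤)
      × (neg (dia ⊥) ≈ ⊤)
proposition6 L neg dia isMC isDia a b =
    ∧-greatest (◇-monotone (x∧y≤x _ _)) (◇-monotone (x∧y≤y _ _))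
  , ∨-least (◇-monotone (x≤x∨y _ _)) (◇-monotone (y≤x∨y _ _))
  , ∨-least (◇-monotone (neg-antitone (x∧y≤x _ _)))
            (◇-monotone (neg-antitone (x∧y≤y _ _)))
  , antisym (◇-neg-antitone (neg-∨-neg a b))
            (◇-monotone (∨-least (neg-antitone (x∧y≤x _ _))
                                 (neg-antitone (x∧y≤y _ _))))
  , ◇≈⊥⇔≈⊥ a
  , ◇-⊤ neg-⊤
  , neg-◇-⊥
  where
    open BoundedLattice L
    open MeetComplement L neg isMC
    open Diamond L neg dia isMC isDia
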